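{- Let $X$ be a set of cardinality $n$, $l\in\{1,\dots,n\}$, $m\in\{1,\dots,l\}$, $t\in\mathbb{R}_{>0}$, and let $\mathcal{F}\subset\binom{X}{m}$ be weighted by $w:\mathcal{F}\to\mathbb{R}_{\ge0}$ so that \[ 0 < \|\mathcal{D}\| \le t\binom{n}{l}\binom{l}{m}^2 e^{ -2\kappa(\mathcal{F})}. \] Let $u,v\in\mathbb{R}_{>0}$ with $u<1$, $u\binom{n}{l}\in\mathbb{Z}$, and $t < uv^2 + \frac{(1-uv)^2}{1-u}$. Then: (a) if $v\ge1$, more than $(1-u)\binom{n}{l}$ sets $Y\in\binom{X}{l}$ satisfy $\left\|\binom{Y}{m}\right\| < v\binom{l}{m}e^{ -\kappa(\mathcal{F})}$; (b) if $v\le1$, more than $(1-u)\binom{n}{l}$ sets $Y\in\binom{X}{l}$ satisfy $\left\|\binom{Y}{m}\right\| > v\binom{l}{m}e^{ -\kappa(\mathcal{F})}$.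
   Context: $\binom{X}{m}$ is the family of $m$-subsets of $X$. Size: $\|\mathcal{G}\|=\sum_{U\in\mathcal{G}\cap\mathcal{F}}w(U)$ for $\mathcal{G}\subset\binom{X}{m}$. Sparsity: $\kappa(\mathcal{F})=\ln\binom{n}{m}-\ln\|\mathcal{F}\|$. $\|\mathcal{D}\| = \sum_{Y\in\binom{X}{l}}\left\|\binom{Y}{m}\right\|^2 = \sum_{U,V\in\mathcal{F}}\sum_{Y\in\binom{X}{l},U\cup V\subset Y}w(U)w(V)$. -}

module Defs where

open import Level using (Level; _⊔_) renaming (suc to lsuc)
open import Data.Bool using (Bool; true; false; _∧_; if_then_else_)
open import Data.Nat as ℕ using (ℕ; zero; suc)
open import Data.Nat.Combinatorics using (_C_)
open import Data.List using (List; []; _∷_; map; _++_; filterᵇ; foldr; length)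
open import Data.List.Relation.Unary.All using (All)
open import Data.List.Relation.Unary.Unique.Propositional using (Unique)
import Data.Vec as V
open import Data.Fin.Subset using (Subset; ∣_∣; _⊆_)
open import Data.Fin.Subset.Properties using (_⊆?_)
open import Data.Product using (Σ; _×_)
open import Relation.Nullary using (¬_; does)
open import Relation.Binary using (Rel; IsStrictTotalOrder)
open import Algebra.Bundles using (CommutativeRing)

-- An ordered field: a commutative ring with a strict total order compatible
-- with + and *, 0 ≠ 1, and a (total) inverse that is a two-sided inverse on
-- nonzero elements.  ℝ is an instance; the statement is made for every such K.
record OrderedField c ℓ₁ ℓ₂ : Set (lsuc (c ⊔ ℓ₁ ⊔ ℓ₂)) where
  field
    commutativeRing : CommutativeRing c ℓ₁
  open CommutativeRing commutativeRing public
  infix 4 _<_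
  field
    _<_ : Rel Carrier ℓ₂
    <-isStrictTotalOrder : IsStrictTotalOrder _≈_ _<_
    +-mono-< : ∀ {x y} z → x < y → x + z < y + z
    *-pos : ∀ {x y} → 0# < x → 0# < y → 0# < x * y
    0≉1 : ¬ (0# ≈ 1#)
    _⁻¹ : Carrier → Carrier
    ⁻¹-inverse : ∀ x → ¬ (x ≈ 0#) → x * (x ⁻¹) ≈ 1#

  infix 4 _≤_
  _≤_ : Rel Carrier (ℓ₁ ⊔ ℓ₂)
  x ≤ y = (x < y) Data.Sum.⊎ (x ≈ y)
    where import Data.Sum

  fromℕ : ℕ → Carrier
  fromℕ zero = 0#
  fromℕ (suc k) = 1# + fromℕ k

  Σ[_]_ : {A : Set} → List A → (A → Carrier) → Carrier
  Σ[ xs ] f = foldr (λ x acc → f x + acc) 0# xs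

allSubsets : (n : ℕ) → List (Subset n)
allSubsets zero = V.[] ∷ []
allSubsets (suc n) = map (false V.∷_) (allSubsets n) ++ map (true V.∷_) (allSubsets n)

kSubsets : (n k : ℕ) → List (Subset n)
kSubsets n k = filterᵇ (λ U → does (∣ U ∣ ℕ.≟ k)) (allSubsets n)

subsetsOf : {n : ℕ} → Subset n → ℕ → List (Subset n)
subsetsOf {n} Y m = filterᵇ (λ U → does (U ⊆? Y)) (kSubsets n m)

module _ {c ℓ₁ ℓ₂} (K : OrderedField c ℓ₁ ℓ₂) where
  open OrderedField K

  norm : {n : ℕ} → (F : Subset n → Bool) → (w : Subset n → Carrier) → List (Subset n) → Carrier
  norm F w G = Σ[ G ] (λ U → if F U then w U else 0#)

  normD : (n l m : ℕ) → (F : Subset n → Bool) → (w : Subset n → Carrier) → Carrier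
  normD n l m F w = Σ[ kSubsets n l ] (λ Y → norm F w (subsetsOf Y m) * norm F w (subsetsOf Y m))

  -- e^{-κ(F)} = exp(ln ‖F‖ - ln binom(n,m)) = ‖F‖ / binom(n,m)
  expNegκ : (n m : ℕ) → (F : Subset n → Bool) → (w : Subset n → Carrier) → Carrier
  expNegκ n m F w = norm F w (kSubsets n m) * (fromℕ (n C m)) ⁻¹

  MoreThan : (n l : ℕ) → Carrier → (Subset n → Set ℓ₂) → Set ℓ₂
  MoreThan n l r P = Σ (List (Subset n)) λ S →
    Unique S × All (λ Y → ∣ Y ∣ ≡ l) S × All P S × (r < fromℕ (length S))
    where open import Relation.Binary.PropositionalEquality using (_≡_)

module Submission where

-- Write a(Y) = ‖binom(Y,m)‖ for the N = binom(n,l) sets Y ∈ binom(X,l).  Double counting the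
-- pairs U ⊆ Y gives Σ a(Y) = N μ with μ = binom(l,m) e^{-κ(F)}, while Σ a(Y)² = ‖D‖ ≤ t N μ².
-- Let S be the sets Y with the required property and suppose |S| = s ≤ (1-u) N.  Bounding a²
-- from below by its tangent at β = (1-uv) μ / (1-u) on S and at γ = v μ off S yields
-- Σ a² ≥ (u v² + (1-uv)²/(1-u)) N μ² + 2 (γ-β)(Σ_{Y∉S} a(Y) - (N-s) γ) + ((1-u) N - s)(γ-β)².
-- Both error terms are nonnegative: γ - β = (v-1) μ / (1-u), and every a(Y) with Y ∉ S lies
-- on the same side of γ as v lies of 1.  Since ‖D‖ > 0 forces N μ² > 0, this contradicts t < u v² + (1-uv)²/(1-u).

open import Algebra.Bundles using (CommutativeRing)
open import Data.Bool using (Bool; true; false; if_then_else_)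
open import Data.Fin.Subset using (Subset; ∣_∣)
open import Data.Fin.Subset.Properties using (_⊆?_)
open import Data.List using (List; []; _∷_; length; filter; filterᵇ)
open import Data.List.Relation.Unary.All as All using (All; []; _∷_)
open import Data.List.Relation.Unary.All.Properties using (all-filter)
open import Data.Nat as ℕ using (ℕ; zero; suc)
import Data.Nat.Properties as ℕₚ
open import Data.Nat.Combinatorics using (_C_)
open import Data.Product using (Σ; _×_; _,_)
open import Data.Sum using (inj₁; inj₂)
open import Relation.Binary.Bundles using (StrictPartialOrder)
open import Relation.Binary.Definitions using (tri<; tri≈; tri>)
import Relation.Binary.PropositionalEquality as ≡
open import Relation.Binary.PropositionalEquality using (_≡_)
open import Relation.Binary.Structures using (IsStrictTotalOrder)
open import Relation.Nullary using (¬_; contradiction; does)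
open import Relation.Unary using (Decidable)
open import Relation.Unary.Properties using (∁?)

open import Defs

-- A coefficient is
-- a pair (a , b) of naturals standing for a - b, kept reduced to (a ∸ b , b ∸ a) so that
-- normal forms can be compared by refl; ⟦_⟧ maps (1 , 0) to 1# and (0 , 0) to 0# definitionally.
module IntegerCoefficientRingSolver {c ℓ} (R : CommutativeRing c ℓ) where
  open import Algebra.Bundles using (RawRing)
  open import Algebra.Solver.Ring.AlmostCommutativeRing
    using (fromCommutativeRing; _-Raw-AlmostCommutative⟶_)
  open import Data.Maybe using (Maybe; just; nothing)
  open import Data.Product.Properties using (≡-dec)
  open import Relation.Nullary using (yes; no)
  import Tactic.RingSolver.Core.AlmostCommutativeRing as Tactic
  import Tactic.RingSolver.NonReflective as NonReflective
  open CommutativeRing R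
  open import Algebra.Properties.Semiring.Mult.TCOptimised semiring
    using (1+×; ×-homo-+; ×1-homo-*) renaming (_×_ to _·_)
  open import Algebra.Properties.CommutativeSemigroup +-commutativeSemigroup using (interchange)
  open import Algebra.Properties.Ring ring using (-‿distribˡ-*; -‿distribʳ-*; -‿involutive; -‿+-comm; ⁻¹-anti-homo‿-; -0#≈0#)
  open import Relation.Binary.Reasoning.Setoid setoid

  difference : ℕ → ℕ → Carrier
  difference a b = a · 1# - b · 1#

  ⟦_⟧ : ℕ × ℕ → Carrier
  ⟦ a     , zero  ⟧ = a · 1#
  ⟦ zero  , suc b ⟧ = - (suc b · 1#)
  ⟦ suc a , suc b ⟧ = ⟦ a , b ⟧

  reduce : ℕ → ℕ → ℕ × ℕ
  reduce a b = (a ℕ.∸ b , b ℕ.∸ a)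

  [o+x]-[o+y]≈x-y : ∀ o x y → (o + x) - (o + y) ≈ x - y
  [o+x]-[o+y]≈x-y o x y = begin
    (o + x) - (o + y)      ≈⟨ +-congˡ (sym (-‿+-comm o y)) ⟩
    (o + x) + (- o + - y)  ≈⟨ interchange o x (- o) (- y) ⟩
    (o - o) + (x - y)      ≈⟨ +-congʳ (-‿inverseʳ o) ⟩
    0# + (x - y)           ≈⟨ +-identityˡ _ ⟩
    x - y                  ∎

  difference-suc : ∀ a b → difference (suc a) (suc b) ≈ difference a b
  difference-suc a b = trans (+-cong (1+× a 1#) (-‿cong (1+× b 1#))) ([o+x]-[o+y]≈x-y 1# (a · 1#) (b · 1#))

  ⟦⟧-sound : ∀ a b → ⟦ a , b ⟧ ≈ difference a b
  ⟦⟧-sound a       zero    = sym (trans (+-congˡ -0#≈0#) (+-identityʳ _))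
  ⟦⟧-sound zero    (suc b) = sym (+-identityˡ _)
  ⟦⟧-sound (suc a) (suc b) = trans (⟦⟧-sound a b) (sym (difference-suc a b))

  reduce-sound : ∀ a b → ⟦ reduce a b ⟧ ≈ difference a b
  reduce-sound zero    zero    = ⟦⟧-sound 0 0
  reduce-sound zero    (suc b) = ⟦⟧-sound 0 (suc b)
  reduce-sound (suc a) zero    = ⟦⟧-sound (suc a) 0
  reduce-sound (suc a) (suc b) = trans (reduce-sound a b) (sym (difference-suc a b))

  IntegerPairs : RawRing _ _
  IntegerPairs = record
    { Carrier = ℕ × ℕ
    ; _≈_     = ≡._≡_
    ; _+_     = λ { (a , b) (c , d) → reduce (a ℕ.+ c) (b ℕ.+ d) }
    ; _*_     = λ { (a , b) (c , d) → reduce (a ℕ.* c ℕ.+ b ℕ.* d) (a ℕ.* d ℕ.+ b ℕ.* c) }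
    ; -_      = λ { (a , b) → (b , a) }
    ; 0#      = (0 , 0)
    ; 1#      = (1 , 0)
    }

  private
    module Plain = NonReflective (Tactic.fromCommutativeRing R (λ _ → nothing))

    +-*-expand : ∀ x y z w → (x + y) * (z + w) ≈ (x * z + y * w) + (x * w + y * z)
    +-*-expand = Plain.solve 4 (λ x y z w → ((x ⊕ y) ⊗ (z ⊕ w)) ⊜ ((x ⊗ z ⊕ y ⊗ w) ⊕ (x ⊗ w ⊕ y ⊗ z))) refl
      where open Plain using (_⊕_; _⊗_; _⊜_)

  -‿*-expand : ∀ x y z w → (x - y) * (z - w) ≈ (x * z + y * w) - (x * w + y * z)
  -‿*-expand x y z w = begin
    (x - y) * (z - w)                               ≈⟨ +-*-expand x (- y) z (- w) ⟩
    (x * z + - y * - w) + (x * - w + - y * z)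
      ≈⟨ +-cong (+-congˡ (trans (sym (-‿distribˡ-* y (- w))) (-‿cong (sym (-‿distribʳ-* y w)))))
                (+-cong (sym (-‿distribʳ-* x w)) (sym (-‿distribˡ-* y z))) ⟩
    (x * z + - - (y * w)) + (- (x * w) + - (y * z))
      ≈⟨ +-cong (+-congˡ (-‿involutive (y * w))) (-‿+-comm (x * w) (y * z)) ⟩
    (x * z + y * w) - (x * w + y * z)               ∎

  ⟦⟧-morphism : IntegerPairs -Raw-AlmostCommutative⟶ fromCommutativeRing R
  ⟦⟧-morphism = record
    { ⟦_⟧    = ⟦_⟧
    ; +-homo = λ { (a , b) (c , d) → begin
        ⟦ reduce (a ℕ.+ c) (b ℕ.+ d) ⟧       ≈⟨ reduce-sound (a ℕ.+ c) (b ℕ.+ d) ⟩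
        (a ℕ.+ c) · 1# - (b ℕ.+ d) · 1#         ≈⟨ +-cong (×-homo-+ 1# a c) (-‿cong (×-homo-+ 1# b d)) ⟩
        (a · 1# + c · 1#) - (b · 1# + d · 1#)   ≈⟨ +-congˡ (sym (-‿+-comm (b · 1#) (d · 1#))) ⟩
        (a · 1# + c · 1#) + (- (b · 1#) + - (d · 1#)) ≈⟨ interchange _ _ _ _ ⟩
        difference a b + difference c d         ≈⟨ sym (+-cong (⟦⟧-sound a b) (⟦⟧-sound c d)) ⟩
        ⟦ a , b ⟧ + ⟦ c , d ⟧                   ∎ }
    ; *-homo = λ { (a , b) (c , d) → begin
        ⟦ reduce (a ℕ.* c ℕ.+ b ℕ.* d) (a ℕ.* d ℕ.+ b ℕ.* c) ⟧
          ≈⟨ reduce-sound (a ℕ.* c ℕ.+ b ℕ.* d) (a ℕ.* d ℕ.+ b ℕ.* c) ⟩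
        (a ℕ.* c ℕ.+ b ℕ.* d) · 1# - (a ℕ.* d ℕ.+ b ℕ.* c) · 1#
          ≈⟨ +-cong (trans (×-homo-+ 1# (a ℕ.* c) (b ℕ.* d)) (+-cong (×1-homo-* a c) (×1-homo-* b d)))
                    (-‿cong (trans (×-homo-+ 1# (a ℕ.* d) (b ℕ.* c)) (+-cong (×1-homo-* a d) (×1-homo-* b c)))) ⟩
        (a · 1# * (c · 1#) + b · 1# * (d · 1#)) - (a · 1# * (d · 1#) + b · 1# * (c · 1#))
          ≈⟨ sym (-‿*-expand (a · 1#) (b · 1#) (c · 1#) (d · 1#)) ⟩
        difference a b * difference c d         ≈⟨ sym (*-cong (⟦⟧-sound a b) (⟦⟧-sound c d)) ⟩
        ⟦ a , b ⟧ * ⟦ c , d ⟧                   ∎ }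
    ; -‿homo = λ { (a , b) → trans (⟦⟧-sound b a)
        (trans (sym (⁻¹-anti-homo‿- (a · 1#) (b · 1#))) (-‿cong (sym (⟦⟧-sound a b)))) }
    ; 0-homo = refl
    ; 1-homo = refl
    }

  ⟦⟧-equal? : ∀ p q → Maybe (⟦ p ⟧ ≈ ⟦ q ⟧)
  ⟦⟧-equal? p q with ≡-dec ℕ._≟_ ℕ._≟_ p q
  ... | yes ≡.refl = just refl
  ... | no _       = nothing

  open import Algebra.Solver.Ring IntegerPairs (fromCommutativeRing R) ⟦⟧-morphism ⟦⟧-equal?
    public using (solve; con; _:+_; _:*_; _:-_; :-_; _:=_)

module OrderedFieldProperties {c ℓ₁ ℓ₂} (K : OrderedField c ℓ₁ ℓ₂) where
  open OrderedField K
  open IsStrictTotalOrder <-isStrictTotalOrder public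
    using (compare; _<?_) renaming (trans to <-trans; irrefl to <-irrefl)
  open IsStrictTotalOrder <-isStrictTotalOrder using (<-resp-≈; <-respʳ-≈; <-respˡ-≈)
  import Relation.Binary.Construct.StrictToNonStrict _≈_ _<_ as NonStrict
  open IntegerCoefficientRingSolver commutativeRing
  open import Algebra.Properties.Ring ring using (-‿distribʳ-*)

  <-strictPartialOrder : StrictPartialOrder c ℓ₁ ℓ₂
  <-strictPartialOrder = record { isStrictPartialOrder = IsStrictTotalOrder.isStrictPartialOrder <-isStrictTotalOrder }

  ≤-trans : ∀ {x y z} → x ≤ y → y ≤ z → x ≤ z
  ≤-trans = NonStrict.trans isEquivalence <-resp-≈ <-trans

  <-≤-trans : ∀ {x y z} → x < y → y ≤ z → x < z
  <-≤-trans = NonStrict.<-≤-trans <-trans <-respʳ-≈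

  ≤-resp-≈ : ∀ {x y x′ y′} → x ≈ x′ → y ≈ y′ → x ≤ y → x′ ≤ y′
  ≤-resp-≈ x≈x′ y≈y′ x≤y = NonStrict.≤-respˡ-≈ sym trans <-respˡ-≈ x≈x′
                             (NonStrict.≤-respʳ-≈ trans <-respʳ-≈ y≈y′ x≤y)

  <-respˡʳ-≈ : ∀ {x y x′ y′} → x ≈ x′ → y ≈ y′ → x < y → x′ < y′
  <-respˡʳ-≈ x≈x′ y≈y′ x<y = <-respˡ-≈ x≈x′ (<-respʳ-≈ y≈y′ x<y)

  ≮⇒≥ : ∀ {x y} → ¬ (x < y) → y ≤ x
  ≮⇒≥ {x} {y} x≮y with compare x y
  ... | tri< x<y _ _ = contradiction x<y x≮y
  ... | tri≈ _ x≈y _ = inj₂ (sym x≈y)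
  ... | tri> _ _ y<x = inj₁ y<x

  ≰⇒> : ∀ {x y} → ¬ (x ≤ y) → y < x
  ≰⇒> {x} {y} x≰y with compare x y
  ... | tri< x<y _ _ = contradiction (inj₁ x<y) x≰y
  ... | tri≈ _ x≈y _ = contradiction (inj₂ x≈y) x≰y
  ... | tri> _ _ y<x = y<x

  +-monoˡ-≤ : ∀ {x y} z → x ≤ y → x + z ≤ y + z
  +-monoˡ-≤ z (inj₁ x<y) = inj₁ (+-mono-< z x<y)
  +-monoˡ-≤ z (inj₂ x≈y) = inj₂ (+-congʳ x≈y)

  +-mono-≤ : ∀ {x y z w} → x ≤ y → z ≤ w → x + z ≤ y + w
  +-mono-≤ {x} {y} {z} {w} x≤y z≤w =
    ≤-trans (+-monoˡ-≤ z x≤y) (≤-resp-≈ (+-comm z y) (+-comm w y) (+-monoˡ-≤ y z≤w))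

  x≤x+y : ∀ {x y} → 0# ≤ y → x ≤ x + y
  x≤x+y {x} {y} 0≤y = ≤-resp-≈ (+-identityˡ x) (+-comm y x) (+-monoˡ-≤ x 0≤y)

  +-nonneg : ∀ {x y} → 0# ≤ x → 0# ≤ y → 0# ≤ x + y
  +-nonneg 0≤x 0≤y = ≤-trans 0≤x (x≤x+y 0≤y)

  x≤y⇒0≤y-x : ∀ {x y} → x ≤ y → 0# ≤ y - x
  x≤y⇒0≤y-x {x} p = ≤-resp-≈ (-‿inverseʳ x) refl (+-monoˡ-≤ (- x) p)

  x<y⇒0<y-x : ∀ {x y} → x < y → 0# < y - x
  x<y⇒0<y-x {x} p = <-respˡ-≈ (-‿inverseʳ x) (+-mono-< (- x) p)

  x<0⇒0<-x : ∀ {x} → x < 0# → 0# < - x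
  x<0⇒0<-x {x} p = <-respʳ-≈ (+-identityˡ (- x)) (x<y⇒0<y-x p)

  *-nonneg : ∀ {x y} → 0# ≤ x → 0# ≤ y → 0# ≤ x * y
  *-nonneg (inj₁ 0<x) (inj₁ 0<y) = inj₁ (*-pos 0<x 0<y)
  *-nonneg {y = y} (inj₂ 0≈x) _ = inj₂ (trans (sym (zeroˡ y)) (*-congʳ 0≈x))
  *-nonneg {x = x} (inj₁ _) (inj₂ 0≈y) = inj₂ (trans (sym (zeroʳ x)) (*-congˡ 0≈y))

  *-monoˡ-< : ∀ {x y z} → 0# < z → x < y → x * z < y * z
  *-monoˡ-< {x} {y} {z} 0<z x<y = <-respˡʳ-≈ (+-identityˡ (x * z)) eq
    (+-mono-< (x * z) (*-pos (x<y⇒0<y-x x<y) 0<z))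
    where eq : (y - x) * z + x * z ≈ y * z
          eq = solve 3 (λ x y z → (y :- x) :* z :+ x :* z := y :* z) refl x y z

  x*x-nonneg : ∀ x → 0# ≤ x * x
  x*x-nonneg x with compare 0# x
  ... | tri< 0<x _ _ = inj₁ (*-pos 0<x 0<x)
  ... | tri≈ _ 0≈x _ = *-nonneg (inj₂ 0≈x) (inj₂ 0≈x)
  ... | tri> _ _ x<0 = inj₁ (<-respʳ-≈ (solve 1 (λ x → :- x :* :- x := x :* x) refl x)
                                       (*-pos (x<0⇒0<-x x<0) (x<0⇒0<-x x<0)))

  0<1 : 0# < 1#
  0<1 with x*x-nonneg 1#
  ... | inj₁ 0<1*1 = <-respʳ-≈ (*-identityˡ 1#) 0<1*1
  ... | inj₂ 0≈1*1 = contradiction (trans 0≈1*1 (*-identityˡ 1#)) 0≉1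

  fromℕ-nonneg : ∀ k → 0# ≤ fromℕ k
  fromℕ-nonneg zero    = inj₂ refl
  fromℕ-nonneg (suc k) = inj₁ (<-≤-trans 0<1 (x≤x+y (fromℕ-nonneg k)))

  fromℕ-pos : ∀ {k} → 0 ℕ.< k → 0# < fromℕ k
  fromℕ-pos {suc k} _ = <-≤-trans 0<1 (x≤x+y (fromℕ-nonneg k))

  fromℕ-+ : ∀ a b → fromℕ (a ℕ.+ b) ≈ fromℕ a + fromℕ b
  fromℕ-+ zero    b = sym (+-identityˡ _)
  fromℕ-+ (suc a) b = trans (+-congˡ (fromℕ-+ a b)) (sym (+-assoc 1# _ _))

  x+y≈z⇒x≈z-y : ∀ {x y z} → x + y ≈ z → x ≈ z - y
  x+y≈z⇒x≈z-y {x} {y} x+y≈z = trans (solve 2 (λ x y → x := x :+ y :- y) refl x y) (+-congʳ x+y≈z)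

  x+y≈z⇒y≈z-x : ∀ {x y z} → x + y ≈ z → y ≈ z - x
  x+y≈z⇒y≈z-x {x} {y} x+y≈z = x+y≈z⇒x≈z-y (trans (+-comm y x) x+y≈z)

  x≤y⇒z≤w⇒0≤[x-y]*[z-w] : ∀ {x y z w} → x ≤ y → z ≤ w → 0# ≤ (x - y) * (z - w)
  x≤y⇒z≤w⇒0≤[x-y]*[z-w] {x} {y} {z} {w} x≤y z≤w =
    ≤-resp-≈ refl (solve 4 (λ x y z w → (y :- x) :* (w :- z) := (x :- y) :* (z :- w)) refl x y z w)
             (*-nonneg (x≤y⇒0≤y-x x≤y) (x≤y⇒0≤y-x z≤w))

  pos-≤-*⇒pos : ∀ {q x y} → 0# < q → q ≤ x * y → 0# ≤ y → 0# < y
  pos-≤-*⇒pos _   _        (inj₁ 0<y) = 0<y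
  pos-≤-*⇒pos {x = x} 0<q q≤x*y (inj₂ 0≈y) =
    contradiction (<-≤-trans 0<q (≤-resp-≈ refl (trans (*-congˡ (sym 0≈y)) (zeroʳ x)) q≤x*y)) (<-irrefl refl)

  pos⇒≉0 : ∀ {x} → 0# < x → ¬ (x ≈ 0#)
  pos⇒≉0 0<x x≈0 = <-irrefl (sym x≈0) 0<x

  ⁻¹-pos : ∀ {x} → 0# < x → 0# < x ⁻¹
  ⁻¹-pos {x} 0<x with compare 0# (x ⁻¹)
  ... | tri< 0<x⁻¹ _ _ = 0<x⁻¹
  ... | tri≈ _ 0≈x⁻¹ _ =
    contradiction (trans (sym (zeroʳ x)) (trans (*-congˡ 0≈x⁻¹) (⁻¹-inverse x (pos⇒≉0 0<x)))) 0≉1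
  ... | tri> _ _ x⁻¹<0 = contradiction (<-trans 0<1 1<0) (<-irrefl refl)
    where
      0<-1 : 0# < - 1#
      0<-1 = <-respʳ-≈ (trans (sym (-‿distribʳ-* x (x ⁻¹))) (-‿cong (⁻¹-inverse x (pos⇒≉0 0<x))))
                       (*-pos 0<x (x<0⇒0<-x x⁻¹<0))
      1<0 : 1# < 0#
      1<0 = <-respˡʳ-≈ (+-identityˡ 1#) (-‿inverseˡ 1#) (+-mono-< 1# 0<-1)

module ListSums {c ℓ₁ ℓ₂} (K : OrderedField c ℓ₁ ℓ₂) where
  open OrderedField K
  open OrderedFieldProperties K
  open IntegerCoefficientRingSolver commutativeRing
  open import Algebra.Properties.CommutativeSemigroup +-commutativeSemigroup using (interchange; x∙yz≈y∙xz)
  open import Relation.Binary.Reasoning.Setoid setoid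

  module _ {A : Set} where
    Σ-cong : ∀ {f g : A → Carrier} {xs} → All (λ x → f x ≈ g x) xs → Σ[ xs ] f ≈ Σ[ xs ] g
    Σ-cong []       = refl
    Σ-cong (p ∷ ps) = +-cong p (Σ-cong ps)

    Σ-zero : ∀ xs → Σ[ xs ] (λ (_ : A) → 0#) ≈ 0#
    Σ-zero []       = refl
    Σ-zero (_ ∷ xs) = trans (+-identityˡ _) (Σ-zero xs)

    Σ-+ : ∀ (f g : A → Carrier) xs → Σ[ xs ] (λ x → f x + g x) ≈ Σ[ xs ] f + Σ[ xs ] g
    Σ-+ f g []       = sym (+-identityˡ 0#)
    Σ-+ f g (x ∷ xs) = trans (+-congˡ (Σ-+ f g xs)) (interchange (f x) (g x) _ _)

    Σ-*ʳ : ∀ (f : A → Carrier) d xs → Σ[ xs ] (λ x → f x * d) ≈ Σ[ xs ] f * d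
    Σ-*ʳ f d []       = sym (zeroˡ d)
    Σ-*ʳ f d (x ∷ xs) = trans (+-congˡ (Σ-*ʳ f d xs)) (sym (distribʳ d (f x) _))

    Σ-affine : ∀ (f : A → Carrier) k d xs →
               Σ[ xs ] (λ x → k * f x + d) ≈ k * Σ[ xs ] f + fromℕ (length xs) * d
    Σ-affine f k d [] = sym (trans (+-cong (zeroʳ k) (zeroˡ d)) (+-identityˡ 0#))
    Σ-affine f k d (x ∷ xs) = trans (+-congˡ (Σ-affine f k d xs))
      (solve 5 (λ k d a s n → (k :* a :+ d) :+ (k :* s :+ n :* d) := k :* (a :+ s) :+ (con (1 , 0) :+ n) :* d)
             refl k d (f x) (Σ[ xs ] f) (fromℕ (length xs)))

    Σ-scaled-deviation : ∀ (f : A → Carrier) k d xs →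
      Σ[ xs ] (λ x → k * (f x - d)) ≈ k * (Σ[ xs ] f - fromℕ (length xs) * d)
    Σ-scaled-deviation f k d xs = begin
      Σ[ xs ] (λ x → k * (f x - d))     ≈⟨ Σ-cong (All.universal (λ x → expand k (f x) d) xs) ⟩
      Σ[ xs ] (λ x → k * f x + - (k * d)) ≈⟨ Σ-affine f k (- (k * d)) xs ⟩
      k * Σ[ xs ] f + fromℕ (length xs) * - (k * d) ≈⟨ collect k (Σ[ xs ] f) (fromℕ (length xs)) d ⟩
      k * (Σ[ xs ] f - fromℕ (length xs) * d) ∎
      where
        expand : ∀ k y d → k * (y - d) ≈ k * y + - (k * d)
        expand = solve 3 (λ k y d → k :* (y :- d) := k :* y :+ :- (k :* d)) refl
        collect : ∀ k s n d → k * s + n * - (k * d) ≈ k * (s - n * d)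
        collect = solve 4 (λ k s n d → k :* s :+ n :* :- (k :* d) := k :* (s :- n :* d)) refl

    Σ-const : ∀ d xs → Σ[ xs ] (λ (_ : A) → d) ≈ fromℕ (length xs) * d
    Σ-const d []       = sym (zeroˡ d)
    Σ-const d (_ ∷ xs) = trans (+-congˡ (Σ-const d xs))
                               (sym (trans (distribʳ d 1# _) (+-congʳ (*-identityˡ d))))

    Σ-mono : ∀ {f g : A → Carrier} {xs} → All (λ x → f x ≤ g x) xs → Σ[ xs ] f ≤ Σ[ xs ] g
    Σ-mono []       = inj₂ refl
    Σ-mono (p ∷ ps) = +-mono-≤ p (Σ-mono ps)

    Σ-nonneg : ∀ {f : A → Carrier} {xs} → All (λ x → 0# ≤ f x) xs → 0# ≤ Σ[ xs ] f
    Σ-nonneg {xs = xs} ps = ≤-resp-≈ (Σ-zero xs) refl (Σ-mono ps)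

    Σ-square-tangent : ∀ (f : A → Carrier) k xs →
                       (k + k) * Σ[ xs ] f - fromℕ (length xs) * (k * k) ≤ Σ[ xs ] (λ x → f x * f x)
    Σ-square-tangent f k xs = ≤-resp-≈ eq refl (Σ-mono (All.universal tangent xs))
      where
        tangent : ∀ x → (k + k) * f x + - (k * k) ≤ f x * f x
        tangent x = ≤-resp-≈ refl (split (f x) k) (x≤x+y (x*x-nonneg (f x - k)))
          where
            split : ∀ y k → (k + k) * y + - (k * k) + (y - k) * (y - k) ≈ y * y
            split = solve 2 (λ y k → (k :+ k) :* y :+ :- (k :* k) :+ (y :- k) :* (y :- k) := y :* y) refl
        eq : Σ[ xs ] (λ x → (k + k) * f x + - (k * k)) ≈ (k + k) * Σ[ xs ] f - fromℕ (length xs) * (k * k)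
        eq = trans (Σ-affine f (k + k) (- (k * k)) xs)
                   (solve 4 (λ a s n k → a :* s :+ n :* :- (k :* k) := a :* s :- n :* (k :* k))
                          refl (k + k) (Σ[ xs ] f) (fromℕ (length xs)) k)

    module _ {p} {P : A → Set p} (P? : Decidable P) where
      Σ-filter-split : ∀ f xs → Σ[ xs ] f ≈ Σ[ filter P? xs ] f + Σ[ filter (∁? P?) xs ] f
      Σ-filter-split f [] = sym (+-identityˡ 0#)
      Σ-filter-split f (x ∷ xs) with does (P? x)
      ... | true  = trans (+-congˡ (Σ-filter-split f xs)) (sym (+-assoc _ _ _))
      ... | false = trans (+-congˡ (Σ-filter-split f xs)) (x∙yz≈y∙xz (f x) _ _)

      length-filter-split : ∀ xs → length (filter P? xs) ℕ.+ length (filter (∁? P?) xs) ≡ length xs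
      length-filter-split [] = ≡.refl
      length-filter-split (x ∷ xs) with does (P? x)
      ... | true  = ≡.cong suc (length-filter-split xs)
      ... | false = ≡.trans (ℕₚ.+-suc _ _) (≡.cong suc (length-filter-split xs))

      Σ-square-two-tangents : ∀ (f : A → Carrier) β γ xs →
        let S = filter P? xs ; S′ = filter (∁? P?) xs in
        ((β + β) * Σ[ S ] f - fromℕ (length S) * (β * β)) + ((γ + γ) * Σ[ S′ ] f - fromℕ (length S′) * (γ * γ))
          ≤ Σ[ xs ] (λ x → f x * f x)
      Σ-square-two-tangents f β γ xs =
        ≤-resp-≈ refl (sym (Σ-filter-split (λ x → f x * f x) xs))
                 (+-mono-≤ (Σ-square-tangent f β (filter P? xs)) (Σ-square-tangent f γ (filter (∁? P?) xs)))

    Σ-filterᵇ : ∀ (p : A → Bool) g xs → Σ[ filterᵇ p xs ] g ≈ Σ[ xs ] (λ x → if p x then g x else 0#)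
    Σ-filterᵇ p g [] = refl
    Σ-filterᵇ p g (x ∷ xs) with p x
    ... | true  = +-congˡ (Σ-filterᵇ p g xs)
    ... | false = trans (Σ-filterᵇ p g xs) (sym (+-identityˡ _))

  module _ {A B : Set} where
    Σ-swap : ∀ (h : A → B → Carrier) xs ys →
             Σ[ ys ] (λ y → Σ[ xs ] (λ x → h x y)) ≈ Σ[ xs ] (λ x → Σ[ ys ] (h x))
    Σ-swap h xs []       = sym (Σ-zero xs)
    Σ-swap h xs (y ∷ ys) = trans (+-congˡ (Σ-swap h xs ys)) (sym (Σ-+ (λ x → h x y) (λ x → Σ[ ys ] (h x)) xs))

    double-count : ∀ (r : A → B → Bool) g xs ys →
                   Σ[ ys ] (λ y → Σ[ filterᵇ (λ x → r x y) xs ] g)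
                     ≈ Σ[ xs ] (λ x → fromℕ (length (filterᵇ (r x) ys)) * g x)
    double-count r g xs ys = begin
      Σ[ ys ] (λ y → Σ[ filterᵇ (λ x → r x y) xs ] g)
        ≈⟨ Σ-cong (All.universal (λ y → Σ-filterᵇ (λ x → r x y) g xs) ys) ⟩
      Σ[ ys ] (λ y → Σ[ xs ] (λ x → if r x y then g x else 0#))
        ≈⟨ Σ-swap (λ x y → if r x y then g x else 0#) xs ys ⟩
      Σ[ xs ] (λ x → Σ[ ys ] (λ y → if r x y then g x else 0#))
        ≈⟨ Σ-cong (All.universal (λ x → sym (count x)) xs) ⟩
      Σ[ xs ] (λ x → fromℕ (length (filterᵇ (r x) ys)) * g x) ∎
      where
        count : ∀ x → fromℕ (length (filterᵇ (r x) ys)) * g x ≈ Σ[ ys ] (λ y → if r x y then g x else 0#)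
        count x = begin
          fromℕ (length (filterᵇ (r x) ys)) * g x ≈⟨ sym (Σ-const (g x) (filterᵇ (r x) ys)) ⟩
          Σ[ filterᵇ (r x) ys ] (λ _ → g x)      ≈⟨ Σ-filterᵇ (r x) (λ _ → g x) ys ⟩
          Σ[ ys ] (λ y → if r x y then g x else 0#) ∎

module SecondMoment {c ℓ₁ ℓ₂} (K : OrderedField c ℓ₁ ℓ₂) where
  open OrderedField K
  open OrderedFieldProperties K
  open ListSums K
  open IntegerCoefficientRingSolver commutativeRing
  open import Relation.Binary.Reasoning.StrictPartialOrder <-strictPartialOrder

  -- i stands for (1-u)⁻¹; the identity holds for free i up to a multiple of e = 1 - (1-u) i.
  two-tangent-identity : ∀ N μ u v i A s →
    let b = (1# - u * v) * i ; β = b * μ ; γ = v * μ ; e = 1# - (1# - u) * i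
        X = μ * i * ((v - 1#) * (A - (N - s) * γ)) in
    ((β + β) * (N * μ - A) - s * (β * β)) + ((γ + γ) * A - (N - s) * (γ * γ))
      ≈ (u * (v * v) + (1# - u * v) * (1# - u * v) * i) * (N * (μ * μ))
        + ((X + X + ((1# - u) * N - s) * ((γ - β) * (γ - β)))
           + e * ((μ * v * (A - (N - s) * γ) + μ * v * (A - (N - s) * γ)) + N * (μ * μ) * b * (1# - u * v)))
  two-tangent-identity = solve 7 (λ N μ u v i A s →
    let o = con (1 , 0) ; b = (o :- u :* v) :* i ; β = b :* μ ; γ = v :* μ ; e = o :- (o :- u) :* i
        X = μ :* i :* ((v :- o) :* (A :- (N :- s) :* γ)) in
    ((β :+ β) :* (N :* μ :- A) :- s :* (β :* β)) :+ ((γ :+ γ) :* A :- (N :- s) :* (γ :* γ))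
      := (u :* (v :* v) :+ (o :- u :* v) :* (o :- u :* v) :* i) :* (N :* (μ :* μ))
        :+ ((X :+ X :+ ((o :- u) :* N :- s) :* ((γ :- β) :* (γ :- β)))
           :+ e :* ((μ :* v :* (A :- (N :- s) :* γ) :+ μ :* v :* (A :- (N :- s) :* γ)) :+ N :* (μ :* μ) :* b :* (o :- u :* v)))) refl

  two-tangent-bound : ∀ {N μ u v i A s} → (1# - u) * i ≈ 1# → 0# < i → 0# ≤ μ →
    s ≤ (1# - u) * N → 0# ≤ (v - 1#) * (A - (N - s) * (v * μ)) →
    let β = (1# - u * v) * i * μ ; γ = v * μ in
    (u * (v * v) + (1# - u * v) * (1# - u * v) * i) * (N * (μ * μ))
      ≤ ((β + β) * (N * μ - A) - s * (β * β)) + ((γ + γ) * A - (N - s) * (γ * γ))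
  two-tangent-bound {N} {μ} {u} {v} {i} {A} {s} [1-u]i≈1 0<i 0≤μ s≤[1-u]N 0≤sign =
    ≤-resp-≈ refl (sym (trans (two-tangent-identity N μ u v i A s) (+-congˡ drop-error)))
             (x≤x+y (+-nonneg (+-nonneg 0≤X 0≤X) 0≤Y))
    where
      β γ X : Carrier
      β = (1# - u * v) * i * μ
      γ = v * μ
      X = μ * i * ((v - 1#) * (A - (N - s) * γ))
      0≤X : 0# ≤ X
      0≤X = *-nonneg (*-nonneg 0≤μ (inj₁ 0<i)) 0≤sign
      0≤Y : 0# ≤ ((1# - u) * N - s) * ((γ - β) * (γ - β))
      0≤Y = *-nonneg (x≤y⇒0≤y-x s≤[1-u]N) (x*x-nonneg (γ - β))
      drop-error : ∀ {y z} → y + (1# - (1# - u) * i) * z ≈ y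
      drop-error {y} {z} = trans (+-congˡ (trans (*-congʳ (trans (+-congˡ (-‿cong [1-u]i≈1)) (-‿inverseʳ 1#)))
                                                       (zeroˡ z)))
                                 (+-identityʳ y)

  module _ {A : Set} {p} {P : A → Set p} (P? : Decidable P) (f : A → Carrier) (xs : List A) where
    length-filter-bound : ∀ {t u v μ} → let N = fromℕ (length xs) in
      Σ[ xs ] f ≈ N * μ →
      0# < Σ[ xs ] (λ x → f x * f x) →
      Σ[ xs ] (λ x → f x * f x) ≤ t * (N * (μ * μ)) →
      0# ≤ μ → u < 1# →
      t < u * (v * v) + (1# - u * v) * (1# - u * v) * (1# - u) ⁻¹ →
      All (λ x → 0# ≤ (v - 1#) * (f x - v * μ)) (filter (∁? P?) xs) →
      (1# - u) * N < fromℕ (length (filter P? xs))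
    length-filter-bound {t} {u} {v} {μ} Σf≈Nμ 0<Σf² Σf²≤tM 0≤μ u<1 t<T signs = ≰⇒> λ s≤[1-u]N →
      <-irrefl refl (begin-strict
        T * M                                      ≤⟨ two-tangent-bound (⁻¹-inverse (1# - u) (pos⇒≉0 0<1-u))
                                                                   (⁻¹-pos 0<1-u) 0≤μ s≤[1-u]N 0≤sign ⟩
        tangent-sum                                ≤⟨ tangent-sum≤Σf² ⟩
        Σ[ xs ] (λ x → f x * f x)                  ≤⟨ Σf²≤tM ⟩
        t * M                                      <⟨ *-monoˡ-< 0<M t<T ⟩
        T * M                                      ∎)
      where
        N M s A′ i T β γ tangent-sum : Carrier
        S S′ : List A
        N = fromℕ (length xs)
        M = N * (μ * μ)
        S = filter P? xs
        S′ = filter (∁? P?) xs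
        s = fromℕ (length S)
        A′ = Σ[ S′ ] f
        i = (1# - u) ⁻¹
        0<1-u : 0# < 1# - u
        0<1-u = x<y⇒0<y-x u<1
        s+s′≈N : s + fromℕ (length S′) ≈ N
        s+s′≈N = trans (sym (fromℕ-+ (length S) (length S′))) (reflexive (≡.cong fromℕ (length-filter-split P? xs)))
        ΣSf+A′≈Nμ : Σ[ S ] f + A′ ≈ N * μ
        ΣSf+A′≈Nμ = trans (sym (Σ-filter-split P? f xs)) Σf≈Nμ
        s′≈N-s : fromℕ (length S′) ≈ N - s
        s′≈N-s = x+y≈z⇒y≈z-x s+s′≈N
        T = u * (v * v) + (1# - u * v) * (1# - u * v) * i
        β = (1# - u * v) * i * μ
        γ = v * μ
        tangent-sum = ((β + β) * (N * μ - A′) - s * (β * β)) + ((γ + γ) * A′ - (N - s) * (γ * γ))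
        tangent-sum≤Σf² : tangent-sum ≤ Σ[ xs ] (λ x → f x * f x)
        tangent-sum≤Σf² = ≤-resp-≈
          (+-cong (+-congʳ (*-congˡ (x+y≈z⇒x≈z-y ΣSf+A′≈Nμ))) (+-congˡ (-‿cong (*-congʳ s′≈N-s))))
          refl (Σ-square-two-tangents P? f β γ xs)
        0≤sign : 0# ≤ (v - 1#) * (A′ - (N - s) * γ)
        0≤sign = ≤-resp-≈ refl (trans (Σ-scaled-deviation f (v - 1#) γ S′) (*-congˡ (+-congˡ (-‿cong (*-congʳ s′≈N-s)))))
                          (Σ-nonneg signs)
        0<M : 0# < M
        0<M = pos-≤-*⇒pos 0<Σf² Σf²≤tM (*-nonneg (fromℕ-nonneg (length xs)) (x*x-nonneg μ))

module SubsetCounting where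
  open import Data.Vec using ([]; _∷_)
  open import Data.List using (map; _++_)
  open import Data.List.Properties using (length-map; length-++; filter-++; filter-none)
  open import Data.List.Relation.Unary.Unique.Propositional using (Unique)
  import Data.List.Relation.Unary.Unique.Propositional.Properties as Unique
  open import Data.List.Relation.Unary.AllPairs using ([]; _∷_)
  open import Data.List.Membership.Propositional using (_∈_)
  open import Data.List.Membership.Propositional.Properties using (∈-map⁻)
  open import Data.Vec.Properties using (∷-injectiveʳ)
  open import Data.Fin.Subset using (inside; outside)
  open import Data.Fin.Subset.Properties using (p⊆q⇒∣p∣≤∣q∣; ∣p∣≤n)
  open import Data.Nat.Combinatorics using (nCk+nC[k+1]≡[n+1]C[k+1])
  open import Data.Bool using (T)
  open import Function using (_∘_)
  open import Relation.Nullary using (Dec; yes)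
  open import Data.Empty using (⊥)
  open ≡ using (refl; cong; cong₂; trans; sym)

  module _ {A B : Set} where
    filterᵇ-map : ∀ (p : B → Bool) (f : A → B) xs → filterᵇ p (map f xs) ≡ map f (filterᵇ (p ∘ f) xs)
    filterᵇ-map p f []       = refl
    filterᵇ-map p f (x ∷ xs) with p (f x)
    ... | true  = cong (f x ∷_) (filterᵇ-map p f xs)
    ... | false = filterᵇ-map p f xs

    length-filterᵇ-map : ∀ (p : B → Bool) (f : A → B) xs → length (filterᵇ p (map f xs)) ≡ length (filterᵇ (p ∘ f) xs)
    length-filterᵇ-map p f xs = trans (cong length (filterᵇ-map p f xs)) (length-map f (filterᵇ (p ∘ f) xs))

  length-filterᵇ-false : ∀ {A : Set} (xs : List A) → length (filterᵇ (λ _ → false) xs) ≡ 0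
  length-filterᵇ-false xs = cong length (filter-none _ (All.universal (λ _ ()) xs))

  -- the l-subsets of Fin (suc n) that contain zero, with zero removed
  kSubsets∋zero : (n l : ℕ) → List (Subset n)
  kSubsets∋zero n l = filterᵇ (λ Y → does (suc ∣ Y ∣ ℕ.≟ l)) (allSubsets n)

  kSubsets∋zero-zero : ∀ n → kSubsets∋zero n zero ≡ []
  kSubsets∋zero-zero n = filter-none _ (All.universal (λ _ ()) (allSubsets n))

  kSubsets-suc : ∀ n l → kSubsets (suc n) l ≡ map (outside ∷_) (kSubsets n l) ++ map (inside ∷_) (kSubsets∋zero n l)
  kSubsets-suc n l = trans (filter-++ _ (map (outside ∷_) (allSubsets n)) (map (inside ∷_) (allSubsets n)))
    (cong₂ _++_ (filterᵇ-map _ (outside ∷_) (allSubsets n)) (filterᵇ-map _ (inside ∷_) (allSubsets n)))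

  length-kSubsets-suc : ∀ n l → length (kSubsets (suc n) l) ≡ length (kSubsets n l) ℕ.+ length (kSubsets∋zero n l)
  length-kSubsets-suc n l = trans (cong length (kSubsets-suc n l))
    (trans (length-++ (map (outside ∷_) (kSubsets n l)))
           (cong₂ ℕ._+_ (length-map (outside ∷_) (kSubsets n l)) (length-map (inside ∷_) (kSubsets∋zero n l))))

  length-filterᵇ-kSubsets-suc : ∀ n l (p : Subset (suc n) → Bool) →
    length (filterᵇ p (kSubsets (suc n) l))
      ≡ length (filterᵇ (p ∘ (outside ∷_)) (kSubsets n l)) ℕ.+ length (filterᵇ (p ∘ (inside ∷_)) (kSubsets∋zero n l))
  length-filterᵇ-kSubsets-suc n l p = begin
    length (filterᵇ p (kSubsets (suc n) l))
      ≡⟨ cong (length ∘ filterᵇ p) (kSubsets-suc n l) ⟩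
    length (filterᵇ p (map (outside ∷_) (kSubsets n l) ++ map (inside ∷_) (kSubsets∋zero n l)))
      ≡⟨ cong length (filter-++ _ (map (outside ∷_) (kSubsets n l)) (map (inside ∷_) (kSubsets∋zero n l))) ⟩
    length (filterᵇ p (map (outside ∷_) (kSubsets n l)) ++ filterᵇ p (map (inside ∷_) (kSubsets∋zero n l)))
      ≡⟨ length-++ (filterᵇ p (map (outside ∷_) (kSubsets n l))) ⟩
    length (filterᵇ p (map (outside ∷_) (kSubsets n l))) ℕ.+ length (filterᵇ p (map (inside ∷_) (kSubsets∋zero n l)))
      ≡⟨ cong₂ ℕ._+_ (length-filterᵇ-map p (outside ∷_) (kSubsets n l)) (length-filterᵇ-map p (inside ∷_) (kSubsets∋zero n l)) ⟩
    length (filterᵇ (p ∘ (outside ∷_)) (kSubsets n l)) ℕ.+ length (filterᵇ (p ∘ (inside ∷_)) (kSubsets∋zero n l)) ∎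
    where open ≡.≡-Reasoning

  pascal : ∀ n k → n C suc k ℕ.+ n C k ≡ suc n C suc k
  pascal n k = trans (ℕₚ.+-comm (n C suc k) (n C k)) (nCk+nC[k+1]≡[n+1]C[k+1] n k)

  nCk>0 : ∀ {n k} → k ℕ.≤ n → 0 ℕ.< n C k
  nCk>0 {k = zero}  _               = ℕ.s≤s ℕ.z≤n
  nCk>0 {suc n} {suc k} (ℕ.s≤s k≤n) =
    ℕₚ.≤-trans (nCk>0 k≤n) (ℕₚ.≤-trans (ℕₚ.m≤m+n _ _) (ℕₚ.≤-reflexive (nCk+nC[k+1]≡[n+1]C[k+1] n k)))

  length-kSubsets : ∀ n l → length (kSubsets n l) ≡ n C l
  length-kSubsets zero    zero    = refl
  length-kSubsets zero    (suc l) = refl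
  length-kSubsets (suc n) zero    = trans (length-kSubsets-suc n zero)
    (cong₂ ℕ._+_ (length-kSubsets n zero) (cong length (kSubsets∋zero-zero n)))
  length-kSubsets (suc n) (suc l) = trans (length-kSubsets-suc n (suc l))
    (trans (cong₂ ℕ._+_ (length-kSubsets n (suc l)) (length-kSubsets n l)) (pascal n l))

  length-subsetsOf : ∀ {n} (Y : Subset n) m → length (subsetsOf Y m) ≡ ∣ Y ∣ C m
  length-subsetsOf []            zero    = refl
  length-subsetsOf []            (suc m) = refl
  length-subsetsOf {suc n} (y ∷ Y) zero = trans (length-filterᵇ-kSubsets-suc n zero _)
    (cong₂ ℕ._+_ (length-subsetsOf Y zero) (cong (length ∘ filterᵇ _) (kSubsets∋zero-zero n)))
  length-subsetsOf {suc n} (outside ∷ Y) (suc m) = trans (length-filterᵇ-kSubsets-suc n (suc m) _)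
    (trans (cong₂ ℕ._+_ (length-subsetsOf Y (suc m)) (length-filterᵇ-false (kSubsets n m))) (ℕₚ.+-identityʳ _))
  length-subsetsOf {suc n} (inside ∷ Y) (suc m) = trans (length-filterᵇ-kSubsets-suc n (suc m) _)
    (trans (cong₂ ℕ._+_ (length-subsetsOf Y (suc m)) (length-subsetsOf Y m)) (pascal ∣ Y ∣ m))

  T-does⇒ : ∀ {p} {P : Set p} (P? : Dec P) → T (does P?) → P
  T-does⇒ (yes p) _ = p

  supersetsOf : ∀ {n} → Subset n → List (Subset n) → List (Subset n)
  supersetsOf U = filterᵇ (λ Y → does (U ⊆? Y))

  length-supersetsOf-smaller : ∀ {n} (U : Subset n) {ys} → All (λ Y → ∣ Y ∣ ℕ.< ∣ U ∣) ys →
                               length (supersetsOf U ys) ≡ 0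
  length-supersetsOf-smaller U smaller = cong length (filter-none _
    (All.map (λ {Y} ∣Y∣<∣U∣ U⊆Y → ℕₚ.<⇒≱ ∣Y∣<∣U∣ (p⊆q⇒∣p∣≤∣q∣ (T-does⇒ (U ⊆? Y) U⊆Y))) smaller))

  kSubsets∋zero-size : ∀ n l → All (λ Y → suc ∣ Y ∣ ≡ l) (kSubsets∋zero n l)
  kSubsets∋zero-size n l = All.map (λ {Y} → T-does⇒ (suc ∣ Y ∣ ℕ.≟ l)) (all-filter _ (allSubsets n))

  length-supersetsOf-offset : ∀ n (U : Subset n) k →
    length (supersetsOf U (kSubsets n (k ℕ.+ ∣ U ∣))) ≡ (n ℕ.∸ ∣ U ∣) C k
  length-supersetsOf-offset zero [] zero    = refl
  length-supersetsOf-offset zero [] (suc k) = refl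
  length-supersetsOf-offset (suc n) (inside ∷ U) k rewrite ℕₚ.+-suc k ∣ U ∣ =
    trans (length-filterᵇ-kSubsets-suc n (suc (k ℕ.+ ∣ U ∣)) _)
          (cong₂ ℕ._+_ (length-filterᵇ-false (kSubsets n (suc (k ℕ.+ ∣ U ∣))))
                       (length-supersetsOf-offset n U k))
  length-supersetsOf-offset (suc n) (outside ∷ U) zero =
    trans (length-filterᵇ-kSubsets-suc n ∣ U ∣ _)
          (cong₂ ℕ._+_ (length-supersetsOf-offset n U zero)
                       (length-supersetsOf-smaller U (All.map ℕₚ.≤-reflexive (kSubsets∋zero-size n ∣ U ∣))))
  length-supersetsOf-offset (suc n) (outside ∷ U) (suc k) =
    trans (length-filterᵇ-kSubsets-suc n (suc (k ℕ.+ ∣ U ∣)) _)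
    (trans (cong₂ ℕ._+_ (length-supersetsOf-offset n U (suc k)) (length-supersetsOf-offset n U k))
    (trans (pascal (n ℕ.∸ ∣ U ∣) k)
           (cong (_C suc k) (sym (ℕₚ.+-∸-assoc 1 (∣p∣≤n U))))))

  length-supersetsOf : ∀ {n} (U : Subset n) {l} → ∣ U ∣ ℕ.≤ l →
    length (supersetsOf U (kSubsets n l)) ≡ (n ℕ.∸ ∣ U ∣) C (l ℕ.∸ ∣ U ∣)
  length-supersetsOf {n} U {l} ∣U∣≤l =
    trans (cong (λ j → length (supersetsOf U (kSubsets n j))) (sym (ℕₚ.m∸n+n≡m ∣U∣≤l)))
          (length-supersetsOf-offset n U (l ℕ.∸ ∣ U ∣))

  kSubsets-size : ∀ n l → All (λ Y → ∣ Y ∣ ≡ l) (kSubsets n l)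
  kSubsets-size n l = All.map (λ {Y} → T-does⇒ (∣ Y ∣ ℕ.≟ l)) (all-filter _ (allSubsets n))

  allSubsets-unique : ∀ n → Unique (allSubsets n)
  allSubsets-unique zero    = [] ∷ []
  allSubsets-unique (suc n) = Unique.++⁺ (Unique.map⁺ ∷-injectiveʳ (allSubsets-unique n))
                                         (Unique.map⁺ ∷-injectiveʳ (allSubsets-unique n)) disjoint
    where
      disjoint : ∀ {Y} → Y ∈ map (outside ∷_) (allSubsets n) × Y ∈ map (inside ∷_) (allSubsets n) → ⊥
      disjoint (Y∈outside , Y∈inside) with ∈-map⁻ (outside ∷_) Y∈outside | ∈-map⁻ (inside ∷_) Y∈inside
      ... | _ , _ , refl | _ , _ , ()

  kSubsets-unique : ∀ n l → Unique (kSubsets n l)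
  kSubsets-unique n l = Unique.filter⁺ _ (allSubsets-unique n)

module WeightedSubsets {c ℓ₁ ℓ₂} (K : OrderedField c ℓ₁ ℓ₂) where
  open OrderedField K
  open OrderedFieldProperties K
  open ListSums K
  open SecondMoment K
  open SubsetCounting
  open IntegerCoefficientRingSolver commutativeRing
  import Data.List.Relation.Unary.All.Properties as AllProperties
  import Data.List.Relation.Unary.Unique.Propositional.Properties as Unique
  open import Relation.Binary.Reasoning.Setoid setoid

  Σ-Σ-subsetsOf : ∀ {n l m} → m ℕ.≤ l → (g : Subset n → Carrier) →
    Σ[ kSubsets n l ] (λ Y → Σ[ subsetsOf Y m ] g) ≈ Σ[ kSubsets n m ] g * fromℕ ((n ℕ.∸ m) C (l ℕ.∸ m))
  Σ-Σ-subsetsOf {n} {l} {m} m≤l g = begin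
    Σ[ kSubsets n l ] (λ Y → Σ[ subsetsOf Y m ] g)
      ≈⟨ double-count (λ U Y → does (U ⊆? Y)) g (kSubsets n m) (kSubsets n l) ⟩
    Σ[ kSubsets n m ] (λ U → fromℕ (length (supersetsOf U (kSubsets n l))) * g U)
      ≈⟨ Σ-cong (All.map supersets-count (kSubsets-size n m)) ⟩
    Σ[ kSubsets n m ] (λ U → g U * D)
      ≈⟨ Σ-*ʳ g D (kSubsets n m) ⟩
    Σ[ kSubsets n m ] g * D ∎
    where
      D : Carrier
      D = fromℕ ((n ℕ.∸ m) C (l ℕ.∸ m))
      supersets-count : ∀ {U} → ∣ U ∣ ≡ m → fromℕ (length (supersetsOf U (kSubsets n l))) * g U ≈ g U * D
      supersets-count {U} ≡.refl = trans (*-congʳ (reflexive (≡.cong fromℕ (length-supersetsOf U m≤l)))) (*-comm _ _)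

  binomial-product : ∀ {n l m} → m ℕ.≤ l →
    fromℕ (n C l) * fromℕ (l C m) ≈ fromℕ (n C m) * fromℕ ((n ℕ.∸ m) C (l ℕ.∸ m))
  binomial-product {n} {l} {m} m≤l = begin
    fromℕ (n C l) * fromℕ (l C m)                     ≈⟨ *-congʳ (reflexive (≡.cong fromℕ (≡.sym (length-kSubsets n l)))) ⟩
    fromℕ (length (kSubsets n l)) * fromℕ (l C m)     ≈⟨ sym (Σ-const _ (kSubsets n l)) ⟩
    Σ[ kSubsets n l ] (λ _ → fromℕ (l C m))          ≈⟨ Σ-cong (All.map count-subsetsOf (kSubsets-size n l)) ⟩
    Σ[ kSubsets n l ] (λ Y → Σ[ subsetsOf Y m ] (λ _ → 1#)) ≈⟨ Σ-Σ-subsetsOf m≤l (λ _ → 1#) ⟩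
    Σ[ kSubsets n m ] (λ _ → 1#) * D                  ≈⟨ *-congʳ (trans (Σ-const 1# (kSubsets n m)) (*-identityʳ _)) ⟩
    fromℕ (length (kSubsets n m)) * D                 ≈⟨ *-congʳ (reflexive (≡.cong fromℕ (length-kSubsets n m))) ⟩
    fromℕ (n C m) * D                                 ∎
    where
      D : Carrier
      D = fromℕ ((n ℕ.∸ m) C (l ℕ.∸ m))
      count-subsetsOf : ∀ {Y : Subset n} → ∣ Y ∣ ≡ l → fromℕ (l C m) ≈ Σ[ subsetsOf Y m ] (λ _ → 1#)
      count-subsetsOf {Y} ∣Y∣≡l = sym (trans (Σ-const 1# (subsetsOf Y m)) (trans (*-identityʳ _)
        (reflexive (≡.cong fromℕ (≡.trans (length-subsetsOf Y m) (≡.cong (_C m) ∣Y∣≡l))))))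

  Σ-norm-subsetsOf : ∀ {n l m} → m ℕ.≤ l → l ℕ.≤ n → ∀ F w →
    Σ[ kSubsets n l ] (λ Y → norm K F w (subsetsOf Y m)) ≈ fromℕ (n C l) * (fromℕ (l C m) * expNegκ K n m F w)
  Σ-norm-subsetsOf {n} {l} {m} m≤l l≤n F w = begin
    Σ[ kSubsets n l ] (λ Y → norm K F w (subsetsOf Y m)) ≈⟨ Σ-Σ-subsetsOf m≤l _ ⟩
    ‖F‖ * D                                         ≈⟨ sym (*-identityʳ _) ⟩
    ‖F‖ * D * 1#                                    ≈⟨ *-congˡ (sym (⁻¹-inverse Cnm (pos⇒≉0 0<Cnm))) ⟩
    ‖F‖ * D * (Cnm * Cnm ⁻¹)                        ≈⟨ regroup ‖F‖ D Cnm (Cnm ⁻¹) ⟩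
    Cnm * D * (‖F‖ * Cnm ⁻¹)                        ≈⟨ *-congʳ (sym (binomial-product m≤l)) ⟩
    fromℕ (n C l) * fromℕ (l C m) * expNegκ K n m F w ≈⟨ *-assoc _ _ _ ⟩
    fromℕ (n C l) * (fromℕ (l C m) * expNegκ K n m F w) ∎
    where
      ‖F‖ D Cnm : Carrier
      ‖F‖ = norm K F w (kSubsets n m)
      D = fromℕ ((n ℕ.∸ m) C (l ℕ.∸ m))
      Cnm = fromℕ (n C m)
      0<Cnm : 0# < Cnm
      0<Cnm = fromℕ-pos (nCk>0 (ℕₚ.≤-trans m≤l l≤n))
      regroup : ∀ f d c i → f * d * (c * i) ≈ c * d * (f * i)
      regroup = solve 4 (λ f d c i → f :* d :* (c :* i) := c :* d :* (f :* i)) refl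

  norm-nonneg : ∀ {n} {F : Subset n → Bool} {w} → (∀ U → F U ≡ true → 0# ≤ w U) → ∀ G → 0# ≤ norm K F w G
  norm-nonneg {F = F} {w} w≥0 G = Σ-nonneg (All.universal weight-nonneg G)
    where
      weight-nonneg : ∀ U → 0# ≤ (if F U then w U else 0#)
      weight-nonneg U with F U in FU
      ... | true  = w≥0 U FU
      ... | false = inj₂ refl

  expNegκ-nonneg : ∀ {n m} {F : Subset n → Bool} {w} → m ℕ.≤ n → (∀ U → F U ≡ true → 0# ≤ w U) →
                   0# ≤ expNegκ K n m F w
  expNegκ-nonneg {n} {m} m≤n w≥0 =
    *-nonneg (norm-nonneg w≥0 (kSubsets n m)) (inj₁ (⁻¹-pos (fromℕ-pos (nCk>0 {n} {m} m≤n))))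

  moreThan-filter : ∀ {n l r} {P : Subset n → Set ℓ₂} (P? : Decidable P) →
                    r < fromℕ (length (filter P? (kSubsets n l))) → MoreThan K n l r P
  moreThan-filter {n} {l} P? r<#P =
    filter P? (kSubsets n l) , Unique.filter⁺ P? (kSubsets-unique n l) ,
    AllProperties.filter⁺ P? (kSubsets-size n l) , all-filter P? (kSubsets n l) , r<#P

  moreThan-by-second-moment : ∀ {n l m} → m ℕ.≤ l → l ℕ.≤ n →
    ∀ {F : Subset n → Bool} {w} → (∀ U → F U ≡ true → 0# ≤ w U) →
    let N = fromℕ (n C l) ; Cₗₘ = fromℕ (l C m) ; E = expNegκ K n m F w
        a = λ Y → norm K F w (subsetsOf Y m) in
    ∀ {t u v} → 0# < normD K n l m F w → normD K n l m F w ≤ t * N * (Cₗₘ * Cₗₘ) * (E * E) →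
    u < 1# → t < u * (v * v) + (1# - u * v) * (1# - u * v) * (1# - u) ⁻¹ →
    ∀ {P : Subset n → Set ℓ₂} (P? : Decidable P) → (∀ {Y} → ¬ P Y → 0# ≤ (v - 1#) * (a Y - v * Cₗₘ * E)) →
    MoreThan K n l ((1# - u) * N) P
  moreThan-by-second-moment {n} {l} {m} m≤l l≤n {F} {w} w≥0 {t} {u} {v} 0<‖D‖ ‖D‖≤ u<1 t<T {P} P? sign =
    moreThan-filter P? (<-respˡʳ-≈ (*-congˡ #L≈N) refl
      (length-filter-bound P? a L Σa≈#Lμ 0<‖D‖ ‖D‖≤t#Lμ² 0≤μ u<1 t<T (All.map sign′ (all-filter (∁? P?) L))))
    where
      L : List (Subset n)
      N Cₗₘ E μ : Carrier
      a : Subset n → Carrier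
      L = kSubsets n l
      N = fromℕ (n C l)
      Cₗₘ = fromℕ (l C m)
      E = expNegκ K n m F w
      μ = Cₗₘ * E
      a Y = norm K F w (subsetsOf Y m)
      #L≈N : fromℕ (length L) ≈ N
      #L≈N = reflexive (≡.cong fromℕ (length-kSubsets n l))
      Σa≈#Lμ : Σ[ L ] a ≈ fromℕ (length L) * μ
      Σa≈#Lμ = trans (Σ-norm-subsetsOf m≤l l≤n F w) (*-congʳ (sym #L≈N))
      ‖D‖≤t#Lμ² : normD K n l m F w ≤ t * (fromℕ (length L) * (μ * μ))
      ‖D‖≤t#Lμ² = ≤-resp-≈ refl (trans (regroup t N Cₗₘ E) (*-congˡ (*-congʳ (sym #L≈N)))) ‖D‖≤
        where
          regroup : ∀ t N C E → t * N * (C * C) * (E * E) ≈ t * (N * ((C * E) * (C * E)))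
          regroup = solve 4 (λ t N C E → t :* N :* (C :* C) :* (E :* E) := t :* (N :* ((C :* E) :* (C :* E)))) refl
      0≤μ : 0# ≤ μ
      0≤μ = *-nonneg (fromℕ-nonneg (l C m)) (expNegκ-nonneg (ℕₚ.≤-trans m≤l l≤n) w≥0)
      sign′ : ∀ {Y} → ¬ P Y → 0# ≤ (v - 1#) * (a Y - v * μ)
      sign′ ¬PY = ≤-resp-≈ refl (*-congˡ (+-congˡ (-‿cong (*-assoc v Cₗₘ E)))) (sign ¬PY)

lemma2p5 : ∀ {c ℓ₁ ℓ₂} (K : OrderedField c ℓ₁ ℓ₂) → let open OrderedField K in
    (n l m : ℕ) → 1 ℕ.≤ l → l ℕ.≤ n → 1 ℕ.≤ m → m ℕ.≤ l →
    (F : Subset n → Bool) → (∀ U → F U ≡ true → ∣ U ∣ ≡ m) →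
    (w : Subset n → Carrier) → (∀ U → F U ≡ true → 0# ≤ w U) →
    (t : Carrier) → 0# < t →
    0# < normD K n l m F w →
    normD K n l m F w ≤ t * fromℕ (n C l) * (fromℕ (l C m) * fromℕ (l C m)) * (expNegκ K n m F w * expNegκ K n m F w) →
    (u v : Carrier) → 0# < u → u < 1# → 0# < v →
    Σ ℕ (λ k → u * fromℕ (n C l) ≈ fromℕ k) →
    t < u * (v * v) + ((1# - u * v) * (1# - u * v)) * (1# - u) ⁻¹ →
    (1# ≤ v → MoreThan K n l ((1# - u) * fromℕ (n C l))
        (λ Y → norm K F w (subsetsOf Y m) < v * fromℕ (l C m) * expNegκ K n m F w))
    × (v ≤ 1# → MoreThan K n l ((1# - u) * fromℕ (n C l))
        (λ Y → v * fromℕ (l C m) * expNegκ K n m F w < norm K F w (subsetsOf Y m)))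
lemma2p5 K n l m _ l≤n _ m≤l F _ w w≥0 t _ 0<‖D‖ ‖D‖≤ u v _ u<1 _ _ t<T =
  (λ 1≤v → many (λ Y → a Y <? c) λ a≮c → *-nonneg (x≤y⇒0≤y-x 1≤v) (x≤y⇒0≤y-x (≮⇒≥ a≮c))) ,
  (λ v≤1 → many (λ Y → c <? a Y) λ c≮a → x≤y⇒z≤w⇒0≤[x-y]*[z-w] v≤1 (≮⇒≥ c≮a))
  where
    open OrderedField K
    open OrderedFieldProperties K
    open WeightedSubsets K
    a : Subset n → Carrier
    a Y = norm K F w (subsetsOf Y m)
    c : Carrier
    c = v * fromℕ (l C m) * expNegκ K n m F w
    many : ∀ {P : Subset n → Set _} (P? : Decidable P) → (∀ {Y} → ¬ P Y → 0# ≤ (v - 1#) * (a Y - c)) →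
           MoreThan K n l ((1# - u) * fromℕ (n C l)) P
    many = moreThan-by-second-moment m≤l l≤n w≥0 0<‖D‖ ‖D‖≤ u<1 t<T
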